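{- Let $P$ be a pre-fork with vertices $\{r,k,k'\}$. Then every full subquiver of $P$ is one of the following: an abundant acyclic quiver; a key with vertices $\{k,k'\}$; a fork with point of return $r$; or a pre-fork with vertices $\{r,k,k'\}$.
   Context: A quiver is a finite directed multigraph with no loops and no 2-cycles; $p_{ij}$ is the number of arrows $i\to j$ in $P$ if positive and minus the number of arrows $j\to i$ otherwise. A full subquiver is induced on a vertex subset; $P\setminus V$ denotes the full subquiver on the vertices not in $V$. Abundant: at least two arrows between every pair of distinct vertices; acyclic: no directed cycle; $F^+(v)=\{j:f_{vj}>0\}$, $F^-(v)=\{j:f_{jv}>0\}$. A fork is an abundant, non-acyclic quiver $F$ with a vertex $r$ (point of return) such that for all $i\in F^-(r)$, $j\in F^+(r)$: $f_{ji}>f_{ir}$ and $f_{ji}>f_{rj}$, and the full subquivers on $F^-(r)$ and $F^+(r)$ are acyclic. A pre-fork with vertices $\{r,k,k'\}$ is a quiver $P$ with $k\ne k'$ such that $P\setminus\{k\}$ and $P\setminus\{k'\}$ are forks with common point of return $r$, and for each vertex $i\notin\{k,k'\}$ either ($k\to i$ and $k'\to i$) or ($i\to k$ and $i\to k'$), with any number (possibly zero) of arrows between $k$ and $k'$. A key with vertices $\{k,k'\}$ is a quiver $Q$ such that $Q\setminus\{k\}$ and $Q\setminus\{k'\}$ are abundant acyclic and the same condition on vertices $i\notin\{k,k'\}$ holds. -}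

module Defs where

open import Level using (0ℓ)
open import Data.Nat using (ℕ; _≤_)
open import Data.Fin using (Fin)
open import Data.Fin.Subset using (Subset; _∈_)
open import Data.Integer using (ℤ; 0ℤ; -_; ∣_∣) renaming (_<_ to _<ℤ_)
open import Data.Product using (_×_)
import Data.Unit as Unit
open import Data.Sum using (_⊎_)
open import Relation.Nullary using (¬_)
open import Relation.Unary using (Pred)
open import Relation.Binary.PropositionalEquality using (_≡_; _≢_)

-- A quiver on vertex set Fin n, given by its skew-symmetric exchange matrix:
-- p i j = number of arrows i → j if positive, minus the number of arrows j → i
-- otherwise.  Skew-symmetry encodes "no loops, no 2-cycles".
record Quiver (n : ℕ) : Set where
  field
    p    : Fin n → Fin n → ℤ
    skew : ∀ i j → p i j ≡ - p j i
open Quiver public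

VSet : ℕ → Set₁
VSet n = Pred (Fin n) 0ℓ

module _ {n : ℕ} (P : Quiver n) where

  Arr : Fin n → Fin n → Set
  Arr i j = 0ℤ <ℤ p P i j

  data Walk (U : VSet n) : Fin n → Fin n → Set where
    edge : ∀ {i j} → U i → U j → Arr i j → Walk U i j
    cons : ∀ {i j l} → U i → Arr i j → Walk U j l → Walk U i l

  Acyclic : VSet n → Set
  Acyclic U = ∀ i → ¬ Walk U i i

  Abundant : VSet n → Set
  Abundant U = ∀ i j → U i → U j → i ≢ j → 2 ≤ ∣ p P i j ∣

  Minus : VSet n → Fin n → VSet n
  Minus U v i = U i × i ≢ v

  Fminus Fplus : VSet n → Fin n → VSet n
  Fminus U r i = U i × Arr i r
  Fplus  U r j = U j × Arr r j

  IsFork : VSet n → Fin n → Set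
  IsFork U r =
    U r × Abundant U × ¬ Acyclic U
    × (∀ i j → Fminus U r i → Fplus U r j →
         (p P i r <ℤ p P j i) × (p P r j <ℤ p P j i))
    × Acyclic (Fminus U r) × Acyclic (Fplus U r)

  SameSide : VSet n → Fin n → Fin n → Set
  SameSide U k k' = ∀ i → U i → i ≢ k → i ≢ k' →
    (Arr k i × Arr k' i) ⊎ (Arr i k × Arr i k')

  IsPreFork : VSet n → Fin n → Fin n → Fin n → Set
  IsPreFork U r k k' =
    U k × U k' × k ≢ k'
    × IsFork (Minus U k) r × IsFork (Minus U k') r
    × SameSide U k k'

  IsKey : VSet n → Fin n → Fin n → Set
  IsKey U k k' =
    U k × U k' × k ≢ k'
    × (Abundant (Minus U k) × Acyclic (Minus U k))
    × (Abundant (Minus U k') × Acyclic (Minus U k'))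
    × SameSide U k k'

All : ∀ {n} → VSet n
All _ = Unit.⊤

⟦_⟧ : ∀ {n} → Subset n → VSet n
⟦ S ⟧ i = i ∈ S

{-# OPTIONS --safe #-}

-- Deleting k or k' from a pre-fork leaves a fork with point of return r, and a
-- full subquiver of a fork is abundant, so it is either acyclic or again a fork
-- at r: away from r, F⁻(r) is closed under successors and F⁺(r) under
-- predecessors, so every cycle passes through r, and one does as soon as r has an
-- in-neighbour i and an out-neighbour j (the cross condition gives j → i).
-- A subquiver missing k or k' is a subquiver of one of these forks.  Otherwise its
-- deletions of k and of k' are each abundant acyclic or a fork, and they agree:
-- renaming k' to k maps cycles avoiding k to cycles avoiding k', because k and k'
-- lie on the same side of every other vertex.  This yields a key or a pre-fork.
module Submission where

open import Defs
open import Data.Nat using (ℕ; _≤_)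
open import Data.Fin using (Fin; _≟_)
open import Data.Fin.Subset using (Subset)
open import Data.Fin.Subset.Properties using (_∈?_)
open import Data.Fin.Properties using (any?)
open import Data.Integer using (0ℤ; ∣_∣) renaming (_<_ to _<ℤ_)
open import Data.Integer.Properties
  using (<-cmp; <-asym; <-trans; neg-mono-<; neg-cancel-<) renaming (_<?_ to _<ℤ?_)
open import Data.Product using (_×_; _,_; ∃; proj₁; proj₂)
open import Data.Sum using (_⊎_; inj₁; inj₂; [_,_]′)
open import Data.Empty using (⊥)
open import Function using (_∘_)
open import Relation.Binary using (tri<; tri≈; tri>)
open import Relation.Binary.PropositionalEquality using (_≢_; refl; sym; subst)
open import Relation.Nullary using (¬_; Dec; yes; no; contradiction)
open import Relation.Nullary.Decidable using (_×-dec_; ¬?)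
open import Relation.Unary using (Decidable; _⊆_; _∩_)

module _ {n : ℕ} (P : Quiver n) where

  Arr-asym : ∀ {i j} → Arr P i j → Arr P j i → ⊥
  Arr-asym {i} {j} i→j j→i =
    <-asym i→j (neg-cancel-< {0ℤ} {p P i j} (subst (0ℤ <ℤ_) (skew P j i) j→i))

  Arr-irrefl : ∀ {i} → ¬ Arr P i i
  Arr-irrefl i→i = Arr-asym i→i i→i

  Arr? : ∀ i j → Dec (Arr P i j)
  Arr? i j = 0ℤ <ℤ? p P i j

  Arr-connex : ∀ {i j} → p P i j ≢ 0ℤ → Arr P i j ⊎ Arr P j i
  Arr-connex {i} {j} p≢0 with <-cmp 0ℤ (p P i j)
  ... | tri< 0<p _ _ = inj₁ 0<p
  ... | tri≈ _ 0≡p _ = contradiction (sym 0≡p) p≢0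
  ... | tri> _ _ p<0 = inj₂ (subst (0ℤ <ℤ_) (sym (skew P j i)) (neg-mono-< p<0))

  Abundant⇒connex : ∀ {U i j} → Abundant P U → U i → U j → i ≢ j → Arr P i j ⊎ Arr P j i
  Abundant⇒connex {i = i} {j} ab ui uj i≢j =
    Arr-connex (λ p≡0 → contradiction (subst (λ z → 2 ≤ ∣ z ∣) p≡0 (ab i j ui uj i≢j)) λ ())

  Abundant-⊆ : ∀ {U W} → U ⊆ W → Abundant P W → Abundant P U
  Abundant-⊆ U⊆W ab i j ui uj = ab i j (U⊆W ui) (U⊆W uj)

  Minus-⊆ : ∀ {U W v} → U ⊆ W → Minus P U v ⊆ Minus P W v
  Minus-⊆ U⊆W (u , x≢v) = U⊆W u , x≢v

  Fminus-⊆ : ∀ {U W r} → U ⊆ W → Fminus P U r ⊆ Fminus P W r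
  Fminus-⊆ U⊆W (u , i→r) = U⊆W u , i→r

  Fplus-⊆ : ∀ {U W r} → U ⊆ W → Fplus P U r ⊆ Fplus P W r
  Fplus-⊆ U⊆W (u , r→j) = U⊆W u , r→j

  Minus? : ∀ {U} → Decidable U → ∀ v → Decidable (Minus P U v)
  Minus? U? v x = U? x ×-dec ¬? (x ≟ v)

  SameSide-⊆ : ∀ {U W k k'} → U ⊆ W → SameSide P W k k' → SameSide P U k k'
  SameSide-⊆ U⊆W same i ui = same i (U⊆W ui)

  SameSide-sym : ∀ {U k k'} → SameSide P U k k' → SameSide P U k' k
  SameSide-sym same i ui i≢k' i≢k with same i ui i≢k i≢k'
  ... | inj₁ (k→i , k'→i) = inj₁ (k'→i , k→i)
  ... | inj₂ (i→k , i→k') = inj₂ (i→k' , i→k)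

  Walk-head : ∀ {U i l} → Walk P U i l → U i
  Walk-head (edge ui _ _) = ui
  Walk-head (cons ui _ _) = ui

  Walk-first-arrow : ∀ {U i l} → Walk P U i l → ∃ λ j → U j × Arr P i j
  Walk-first-arrow (edge _ uj i→j) = _ , uj , i→j
  Walk-first-arrow (cons _ i→j w) = _ , Walk-head w , i→j

  Walk-last-arrow : ∀ {U i l} → Walk P U i l → ∃ λ j → U j × Arr P j l
  Walk-last-arrow (edge ui _ i→l) = _ , ui , i→l
  Walk-last-arrow (cons _ _ w) = Walk-last-arrow w

  Walk-⊆ : ∀ {U W} → U ⊆ W → ∀ {i l} → Walk P U i l → Walk P W i l
  Walk-⊆ U⊆W (edge ui ul i→l) = edge (U⊆W ui) (U⊆W ul) i→l
  Walk-⊆ U⊆W (cons ui i→j w) = cons (U⊆W ui) i→j (Walk-⊆ U⊆W w)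

  Acyclic-⊆ : ∀ {U W} → U ⊆ W → Acyclic P W → Acyclic P U
  Acyclic-⊆ U⊆W ac i = ac i ∘ Walk-⊆ U⊆W

  Walk-restrict-forward : ∀ {U V} → (∀ {a b} → U a → U b → Arr P a b → V a → V b) →
                          ∀ {i l} → Walk P U i l → V i → Walk P (U ∩ V) i l
  Walk-restrict-forward step (edge ui ul i→l) vi = edge (ui , vi) (ul , step ui ul i→l vi) i→l
  Walk-restrict-forward step (cons ui i→j w) vi =
    cons (ui , vi) i→j (Walk-restrict-forward step w (step ui (Walk-head w) i→j vi))

  Walk-restrict-backward : ∀ {U V} → (∀ {a b} → U a → U b → Arr P a b → V b → V a) →
                           ∀ {i l} → Walk P U i l → V l → Walk P (U ∩ V) i l
  Walk-restrict-backward step (edge ui ul i→l) vl = edge (ui , step ui ul i→l vl) (ul , vl) i→l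
  Walk-restrict-backward step (cons ui i→j w) vl =
    let w' = Walk-restrict-backward step w vl
    in cons (ui , step ui (Walk-head w) i→j (proj₂ (Walk-head w'))) i→j w'

  Walk-avoid-or-enter : ∀ {U i l} r → i ≢ r → l ≢ r → Walk P U i l →
                        Walk P (Minus P U r) i l ⊎ (∃ (Fminus P U r) × Walk P U r l)
  Walk-avoid-or-enter r i≢r l≢r (edge ui ul i→l) = inj₁ (edge (ui , i≢r) (ul , l≢r) i→l)
  Walk-avoid-or-enter r i≢r l≢r (cons {j = j} ui i→j w) with j ≟ r
  ... | yes refl = inj₂ ((_ , ui , i→j) , w)
  ... | no j≢r = [ inj₁ ∘ cons (ui , i≢r) i→j , inj₂ ]′ (Walk-avoid-or-enter r j≢r l≢r w)

  InOut : VSet n → Fin n → Set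
  InOut U r = U r × ∃ (Fminus P U r) × ∃ (Fplus P U r)

  InOut? : ∀ {U} → Decidable U → ∀ r → Dec (InOut U r)
  InOut? U? r =
    U? r ×-dec any? (λ i → U? i ×-dec Arr? i r) ×-dec any? (λ j → U? j ×-dec Arr? r j)

  cycle-avoids-or-InOut : ∀ {U x} r → Walk P U x x → Walk P (Minus P U r) x x ⊎ InOut U r
  cycle-avoids-or-InOut {x = x} r w with x ≟ r
  ... | yes refl = inj₂ (Walk-head w , Walk-last-arrow w , Walk-first-arrow w)
  ... | no x≢r with Walk-avoid-or-enter r x≢r x≢r w
  ...   | inj₁ w-avoids = inj₁ w-avoids
  ...   | inj₂ (into-r , w-from-r) =
    inj₂ (Walk-head w-from-r , into-r , Walk-first-arrow w-from-r)

  fork-back-arrow : ∀ {F r i j} → IsFork P F r → Fminus P F r i → Fplus P F r j → Arr P j i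
  fork-back-arrow (_ , _ , _ , cross , _) i∈F⁻ j∈F⁺ =
    <-trans (proj₂ i∈F⁻) (proj₁ (cross _ _ i∈F⁻ j∈F⁺))

  fork-off-return-acyclic : ∀ {F r} → IsFork P F r → Acyclic P (Minus P F r)
  fork-off-return-acyclic {F} {r} fork@(Fr , abF , _ , _ , acF⁻ , acF⁺) x w
    with Walk-head w
  ... | Fx , x≢r with Abundant⇒connex abF Fx Fr x≢r
  ...   | inj₁ x→r = acF⁻ x (Walk-⊆ forget (Walk-restrict-forward successor w x→r))
    where
    forget : Minus P F r ∩ (λ a → Arr P a r) ⊆ Fminus P F r
    forget ((Fa , _) , a→r) = Fa , a→r
    successor : ∀ {a b} → Minus P F r a → Minus P F r b → Arr P a b → Arr P a r → Arr P b r
    successor (Fa , _) (Fb , b≢r) a→b a→r with Abundant⇒connex abF Fb Fr b≢r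
    ... | inj₁ b→r = b→r
    ... | inj₂ r→b = contradiction (fork-back-arrow fork (Fa , a→r) (Fb , r→b)) (Arr-asym a→b)
  ...   | inj₂ r→x = acF⁺ x (Walk-⊆ forget (Walk-restrict-backward predecessor w r→x))
    where
    forget : Minus P F r ∩ Arr P r ⊆ Fplus P F r
    forget ((Fa , _) , r→a) = Fa , r→a
    predecessor : ∀ {a b} → Minus P F r a → Minus P F r b → Arr P a b → Arr P r b → Arr P r a
    predecessor (Fa , a≢r) (Fb , _) a→b r→b with Abundant⇒connex abF Fa Fr a≢r
    ... | inj₂ r→a = r→a
    ... | inj₁ a→r = contradiction (fork-back-arrow fork (Fa , a→r) (Fb , r→b)) (Arr-asym a→b)

  AbundantAcyclic⊎Fork : VSet n → Fin n → Set
  AbundantAcyclic⊎Fork U r = (Abundant P U × Acyclic P U) ⊎ IsFork P U r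

  subquiver-of-fork : ∀ {F U r} → IsFork P F r → U ⊆ F → Decidable U →
                      AbundantAcyclic⊎Fork U r
  subquiver-of-fork {F} {U} {r} fork@(_ , abF , _ , cross , acF⁻ , acF⁺) U⊆F U?
    with InOut? U? r
  ... | yes (Ur , (i , i∈U⁻) , (j , j∈U⁺)) =
    inj₂ (Ur , Abundant-⊆ U⊆F abF , (λ ac → ac r r→j→i→r)
         , (λ a b a∈U⁻ b∈U⁺ → cross a b (U⁻⊆F⁻ a∈U⁻) (U⁺⊆F⁺ b∈U⁺))
         , Acyclic-⊆ U⁻⊆F⁻ acF⁻ , Acyclic-⊆ U⁺⊆F⁺ acF⁺)
    where
    U⁻⊆F⁻ : Fminus P U r ⊆ Fminus P F r
    U⁻⊆F⁻ = Fminus-⊆ {U} {F} U⊆F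
    U⁺⊆F⁺ : Fplus P U r ⊆ Fplus P F r
    U⁺⊆F⁺ = Fplus-⊆ {U} {F} U⊆F
    r→j→i→r : Walk P U r r
    r→j→i→r = cons Ur (proj₂ j∈U⁺)
                (cons (proj₁ j∈U⁺) (fork-back-arrow fork (U⁻⊆F⁻ i∈U⁻) (U⁺⊆F⁺ j∈U⁺))
                  (edge (proj₁ i∈U⁻) Ur (proj₂ i∈U⁻)))
  ... | no ¬InOut = inj₁ (Abundant-⊆ U⊆F abF , acU)
    where
    acU : Acyclic P U
    acU x w = [ fork-off-return-acyclic fork x ∘ Walk-⊆ (Minus-⊆ {U} {F} U⊆F) , ¬InOut ]′
                (cycle-avoids-or-InOut r w)

  Acyclic-exchange : ∀ {U k k'} → U k → k ≢ k' → SameSide P U k k' →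
                     Acyclic P (Minus P U k') → Acyclic P (Minus P U k)
  Acyclic-exchange {U} {k} {k'} Uk k≢k' same ac x w = ac (rename x) (rename-walk w)
    where
    rename : Fin n → Fin n
    rename a with a ≟ k'
    ... | yes _ = k
    ... | no _ = a

    rename-vertex : Minus P U k ⊆ Minus P U k' ∘ rename
    rename-vertex {a} (Ua , a≢k) with a ≟ k'
    ... | yes _ = Uk , k≢k'
    ... | no a≢k' = Ua , a≢k'

    rename-arrow : ∀ {a b} → Minus P U k a → Minus P U k b →
                   Arr P a b → Arr P (rename a) (rename b)
    rename-arrow {a} {b} (Ua , a≢k) (Ub , b≢k) a→b with a ≟ k' | b ≟ k'
    ... | yes refl | yes refl = contradiction a→b Arr-irrefl
    ... | yes refl | no b≢k' with same b Ub b≢k b≢k'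
    ...   | inj₁ (k→b , _) = k→b
    ...   | inj₂ (_ , b→k') = contradiction b→k' (Arr-asym a→b)
    rename-arrow {a} {b} (Ua , a≢k) (Ub , b≢k) a→b | no a≢k' | yes refl with same a Ua a≢k a≢k'
    ...   | inj₁ (_ , k'→a) = contradiction k'→a (Arr-asym a→b)
    ...   | inj₂ (a→k , _) = a→k
    rename-arrow _ _ a→b | no _ | no _ = a→b

    rename-walk : ∀ {i l} → Walk P (Minus P U k) i l →
                  Walk P (Minus P U k') (rename i) (rename l)
    rename-walk (edge ui ul i→l) =
      edge (rename-vertex ui) (rename-vertex ul) (rename-arrow ui ul i→l)
    rename-walk (cons ui i→j w) =
      cons (rename-vertex ui) (rename-arrow ui (Walk-head w) i→j) (rename-walk w)

  key-or-prefork : ∀ {U r k k'} → U k → U k' → k ≢ k' → SameSide P U k k' →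
                   AbundantAcyclic⊎Fork (Minus P U k) r → AbundantAcyclic⊎Fork (Minus P U k') r →
                   IsKey P U k k' ⊎ IsPreFork P U r k k'
  key-or-prefork Uk Uk' k≢k' same (inj₁ acyc) (inj₁ acyc') =
    inj₁ (Uk , Uk' , k≢k' , acyc , acyc' , same)
  key-or-prefork Uk Uk' k≢k' same (inj₂ fork) (inj₂ fork') =
    inj₂ (Uk , Uk' , k≢k' , fork , fork' , same)
  key-or-prefork Uk Uk' k≢k' same (inj₂ (_ , _ , cyclic , _)) (inj₁ (_ , acyc')) =
    contradiction (Acyclic-exchange Uk k≢k' same acyc') cyclic
  key-or-prefork Uk Uk' k≢k' same (inj₁ (_ , acyc)) (inj₂ (_ , _ , cyclic' , _)) =
    contradiction (Acyclic-exchange Uk' (k≢k' ∘ sym) (SameSide-sym same) acyc) cyclic'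

  subquiver-of-prefork-with : ∀ {W U r k k'} → IsPreFork P W r k k' → U ⊆ W → Decidable U →
                              U k → U k' → IsKey P U k k' ⊎ IsPreFork P U r k k'
  subquiver-of-prefork-with {W} {U} {k = k} {k'} (_ , _ , k≢k' , fork , fork' , same)
                            U⊆W U? Uk Uk' =
    key-or-prefork Uk Uk' k≢k' (SameSide-⊆ {U} {W} U⊆W same)
      (subquiver-of-fork fork (Minus-⊆ {U} {W} U⊆W) (Minus? U? k))
      (subquiver-of-fork fork' (Minus-⊆ {U} {W} U⊆W) (Minus? U? k'))

  subquiver-of-fork-without : ∀ {W U r v} → IsFork P (Minus P W v) r → U ⊆ W →
                              Decidable U → ¬ U v → AbundantAcyclic⊎Fork U r
  subquiver-of-fork-without fork U⊆W U? ¬Uv =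
    subquiver-of-fork fork (λ Ux → U⊆W Ux , λ { refl → ¬Uv Ux }) U?

lemma4p9 : ∀ {n : ℕ} (P : Quiver n) (r k k' : Fin n) →
    IsPreFork P All r k k' →
    (S : Subset n) →
    (Abundant P ⟦ S ⟧ × Acyclic P ⟦ S ⟧)
    ⊎ IsKey P ⟦ S ⟧ k k'
    ⊎ IsFork P ⟦ S ⟧ r
    ⊎ IsPreFork P ⟦ S ⟧ r k k'
lemma4p9 P r k k' prefork@(_ , _ , _ , fork , fork' , _) S with k ∈? S | k' ∈? S
... | no k∉S | _ =
  [ inj₁ , inj₂ ∘ inj₂ ∘ inj₁ ]′ (subquiver-of-fork-without P {All} fork _ (_∈? S) k∉S)
... | yes _ | no k'∉S =
  [ inj₁ , inj₂ ∘ inj₂ ∘ inj₁ ]′ (subquiver-of-fork-without P {All} fork' _ (_∈? S) k'∉S)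
... | yes k∈S | yes k'∈S =
  inj₂ ([ inj₁ , inj₂ ∘ inj₂ ]′ (subquiver-of-prefork-with P prefork _ (_∈? S) k∈S k'∈S))
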